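{- Let $n,r,s$ be positive integers. Let $W_n$ and $Z_n$ be the Horadam quaternions built from the Horadam sequences $w_n=w_n(w_0,w_1;p,q)$ and $z_n=w_n(z_0,z_1;p,q)$ respectively. Then $$Z_{n+r}W_{n+s}-Z_nW_{n+r+s}=(-q)^n u_r\left(Z_1W_s-Z_0W_{s+1}\right).$$
   Context: Let $H$ be the real quaternion algebra with basis $1,i,j,k$ and (non-commutative) multiplication determined by $i^2=j^2=k^2=-1$, $ij=-ji=k$, $jk=-kj=i$, $ki=-ik=j$; real scalars commute with all quaternions. Fix real numbers $p,q$. For real $a,b$, the Horadam sequence $w_n(a,b;p,q)$ is defined by $w_0=a$, $w_1=b$, $w_n=pw_{n-1}+qw_{n-2}$ for $n\ge 2$. Let $u_n=w_n(0,1;p,q)$ (the $(p,q)$-Fibonacci numbers). For a Horadam sequence $(x_n)$ the associated Horadam quaternions are $X_n=x_n+x_{n+1}i+x_{n+2}j+x_{n+3}k$; thus $W_n=w_n+w_{n+1}i+w_{n+2}j+w_{n+3}k$ and $Z_n=z_n+z_{n+1}i+z_{n+2}j+z_{n+3}k$. -}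

module Defs where

open import Level using (Level)
open import Data.Nat using (ℕ; zero; suc)
open import Algebra.Bundles using (CommutativeRing)

-- Everything is developed over an arbitrary commutative ring R of scalars
-- (the paper uses R = ℝ; Agda's stdlib has no real numbers).
module Quat {c ℓ : Level} (R : CommutativeRing c ℓ) where
  open CommutativeRing R

  pow : Carrier → ℕ → Carrier
  pow x zero    = 1#
  pow x (suc n) = x * pow x n

  horadam : (a b p q : Carrier) → ℕ → Carrier
  horadam a b p q zero          = a
  horadam a b p q (suc zero)    = b
  horadam a b p q (suc (suc n)) = p * horadam a b p q (suc n) + q * horadam a b p q n

  fib : (p q : Carrier) → ℕ → Carrier
  fib p q = horadam 0# 1# p q

  record ℍ : Set c where
    constructor quat
    field
      re ci cj ck : Carrier
  open ℍ public

  -- Hamilton product (i²=j²=k²=-1, ij=k, jk=i, ki=j)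
  _*ℍ_ : ℍ → ℍ → ℍ
  quat a1 b1 c1 d1 *ℍ quat a2 b2 c2 d2 = quat
    (a1 * a2 - b1 * b2 - c1 * c2 - d1 * d2)
    (a1 * b2 + b1 * a2 + c1 * d2 - d1 * c2)
    (a1 * c2 - b1 * d2 + c1 * a2 + d1 * b2)
    (a1 * d2 + b1 * c2 - c1 * b2 + d1 * a2)

  _-ℍ_ : ℍ → ℍ → ℍ
  quat a1 b1 c1 d1 -ℍ quat a2 b2 c2 d2 = quat (a1 - a2) (b1 - b2) (c1 - c2) (d1 - d2)

  _·ℍ_ : Carrier → ℍ → ℍ
  x ·ℍ quat a b c' d = quat (x * a) (x * b) (x * c') (x * d)

  _≈ℍ_ : ℍ → ℍ → Set ℓ
  quat a1 b1 c1 d1 ≈ℍ quat a2 b2 c2 d2 =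
    (a1 ≈ a2) × ((b1 ≈ b2) × ((c1 ≈ c2) × (d1 ≈ d2)))
    where open import Data.Product using (_×_)

  horadamQ : (ℕ → Carrier) → ℕ → ℍ
  horadamQ x n = quat (x n) (x (suc n)) (x (suc (suc n))) (x (suc (suc (suc n))))

module Submission where

open import Defs
open import Level using (Level; 0ℓ)
open import Data.Nat as ℕ using (ℕ; zero; suc; _+_; _≤_)
import Data.Nat.Properties as ℕP
open import Data.Integer as ℤ using (ℤ; +_; -[1+_]; _⊖_; sign; ∣_∣; _◃_)
import Data.Integer.Properties as ℤP
open import Data.Sign as Sign using (Sign)
open import Data.Fin using (Fin; toℕ)
open import Data.Fin.Patterns using (0F; 1F; 2F; 3F)
open import Data.Maybe using (Maybe; just; nothing)
open import Data.Product using (_,_)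
open import Relation.Nullary using (yes; no)
open import Relation.Binary.PropositionalEquality as ≡ using (_≡_)
open import Algebra.Bundles using (CommutativeRing; RawRing)
open import Algebra.Solver.Ring.AlmostCommutativeRing
  using (AlmostCommutativeRing; fromCommutativeRing; _-Raw-AlmostCommutative⟶_)

-- The identity is first proved for scalars (module HoradamSequences): for
-- any two sequences a, b obeying x(m+2) = p x(m+1) + q x(m) and r ≥ 1,
--   a(n+r) b(n+s) − a(n) b(n+r+s) = (−q)ⁿ u(r) (a(1) b(s) − a(0) b(s+1)).
-- It combines two facts: the cross difference a(m+1) b(k) − a(m) b(k+1)
-- is multiplied by −q when both indices advance by one, and the addition
-- formula x(r+m) = u(r) x(m+1) + q u(r−1) x(m).
--
-- Each coordinate of A B − C D is a signed sum of the sixteen differences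
-- Aᵢ Bⱼ − Cᵢ Dⱼ, so if every such difference is k times the corresponding
-- one for A′, B′, C′, D′, then A B − C D = k (A′ B′ − C′ D′).  For Horadam
-- quaternions these differences are the scalar identity for the shifted
-- sequences m ↦ z(i + m) and m ↦ w(j + m).

module IntegerCoefficientSolver {c ℓ : Level} (R : CommutativeRing c ℓ) where
  open CommutativeRing R renaming (_+_ to _+R_)
  open import Algebra.Properties.Ring ring using (-1*x≈-x; -0#≈0#; -‿involutive; -‿+-comm)
  open import Algebra.Properties.Semiring.Mult semiring using (_×_; ×-homo-+; ×1-homo-*)
  open import Algebra.Properties.CommutativeSemigroup +-commutativeSemigroup using (interchange)
  open import Algebra.Properties.CommutativeSemigroup *-commutativeSemigroup using (x∙yz≈y∙xz)
  open import Relation.Binary.Reasoning.Setoid setoid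

  ι : ℕ → Carrier
  ι n = n × 1#

  ⟦_⟧ℤ : ℤ → Carrier
  ⟦ + n ⟧ℤ      = ι n
  ⟦ -[1+ n ] ⟧ℤ = - ι (suc n)

  -- ⟦_⟧ℤ turns the natural-number difference m ⊖ n into ι m − ι n;
  -- this is the mixed-sign case of additivity
  ⊖-homo : ∀ m n → ⟦ m ⊖ n ⟧ℤ ≈ ι m - ι n
  ⊖-homo m zero = begin
    ι m        ≈⟨ +-identityʳ (ι m) ⟨
    ι m +R 0#  ≈⟨ +-congˡ -0#≈0# ⟨
    ι m - 0#   ∎
  ⊖-homo zero (suc n) = sym (+-identityˡ _)
  ⊖-homo (suc m) (suc n) = begin
    ⟦ suc m ⊖ suc n ⟧ℤ           ≡⟨ ≡.cong ⟦_⟧ℤ (ℤP.[1+m]⊖[1+n]≡m⊖n m n) ⟩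
    ⟦ m ⊖ n ⟧ℤ                   ≈⟨ ⊖-homo m n ⟩
    ι m - ι n                    ≈⟨ +-identityˡ _ ⟨
    0# +R (ι m - ι n)            ≈⟨ +-congʳ (-‿inverseʳ 1#) ⟨
    (1# - 1#) +R (ι m - ι n)     ≈⟨ interchange 1# (- 1#) (ι m) (- ι n) ⟩
    (1# +R ι m) +R (- 1# - ι n)  ≈⟨ +-congˡ (-‿+-comm 1# (ι n)) ⟩
    ι (suc m) - ι (suc n)        ∎

  +-homo : ∀ i j → ⟦ i ℤ.+ j ⟧ℤ ≈ ⟦ i ⟧ℤ +R ⟦ j ⟧ℤ
  +-homo (+ m)      (+ n)      = ×-homo-+ 1# m n
  +-homo (+ m)      -[1+ n ]   = ⊖-homo m (suc n)
  +-homo -[1+ m ]   (+ n)      = trans (⊖-homo n (suc m)) (+-comm _ _)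
  +-homo -[1+ m ]   -[1+ n ]   = begin
    - ι (suc (suc (m + n)))     ≡⟨ ≡.cong (λ t → - ι (suc t)) (ℕP.+-suc m n) ⟨
    - ι (suc m + suc n)         ≈⟨ -‿cong (×-homo-+ 1# (suc m) (suc n)) ⟩
    - (ι (suc m) +R ι (suc n))  ≈⟨ -‿+-comm _ _ ⟨
    - ι (suc m) - ι (suc n)     ∎

  -‿homo : ∀ i → ⟦ ℤ.- i ⟧ℤ ≈ - ⟦ i ⟧ℤ
  -‿homo (+ zero)   = sym -0#≈0#
  -‿homo (+ suc n)  = refl
  -‿homo -[1+ n ]   = sym (-‿involutive _)

  σ : Sign → Carrier
  σ Sign.+ = 1#
  σ Sign.- = - 1#

  -- integer multiplication multiplies signs and absolute values separately,
  -- so *-homo reduces to the following three facts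
  σ-homo : ∀ s t → σ (s Sign.* t) ≈ σ s * σ t
  σ-homo Sign.+ Sign.+ = sym (*-identityˡ _)
  σ-homo Sign.+ Sign.- = sym (*-identityˡ _)
  σ-homo Sign.- Sign.+ = sym (*-identityʳ _)
  σ-homo Sign.- Sign.- = sym (trans (-1*x≈-x (- 1#)) (-‿involutive 1#))

  ◃-homo : ∀ s n → ⟦ s ◃ n ⟧ℤ ≈ σ s * ι n
  ◃-homo s        zero    = sym (zeroʳ _)
  ◃-homo Sign.+   (suc n) = sym (*-identityˡ _)
  ◃-homo Sign.-   (suc n) = sym (-1*x≈-x _)

  sign-abs : ∀ i → ⟦ i ⟧ℤ ≈ σ (sign i) * ι ∣ i ∣
  sign-abs (+ n)      = sym (*-identityˡ _)
  sign-abs -[1+ n ]   = sym (-1*x≈-x _)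

  *-homo : ∀ i j → ⟦ i ℤ.* j ⟧ℤ ≈ ⟦ i ⟧ℤ * ⟦ j ⟧ℤ
  *-homo i j = begin
    ⟦ (sign i Sign.* sign j) ◃ (∣ i ∣ ℕ.* ∣ j ∣) ⟧ℤ  ≈⟨ ◃-homo (sign i Sign.* sign j) (∣ i ∣ ℕ.* ∣ j ∣) ⟩
    σ (sign i Sign.* sign j) * ι (∣ i ∣ ℕ.* ∣ j ∣)   ≈⟨ *-cong (σ-homo (sign i) (sign j)) (×1-homo-* ∣ i ∣ ∣ j ∣) ⟩
    (σ (sign i) * σ (sign j)) * (ι ∣ i ∣ * ι ∣ j ∣)   ≈⟨ *-assoc _ _ _ ⟩
    σ (sign i) * (σ (sign j) * (ι ∣ i ∣ * ι ∣ j ∣))   ≈⟨ *-congˡ (x∙yz≈y∙xz _ _ _) ⟩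
    σ (sign i) * (ι ∣ i ∣ * (σ (sign j) * ι ∣ j ∣))   ≈⟨ *-assoc _ _ _ ⟨
    (σ (sign i) * ι ∣ i ∣) * (σ (sign j) * ι ∣ j ∣)   ≈⟨ *-cong (sign-abs i) (sign-abs j) ⟨
    ⟦ i ⟧ℤ * ⟦ j ⟧ℤ                                   ∎

  ℤ-rawRing : RawRing 0ℓ 0ℓ
  ℤ-rawRing = CommutativeRing.rawRing ℤP.+-*-commutativeRing

  R-almost : AlmostCommutativeRing c ℓ
  R-almost = fromCommutativeRing R

  morphism : ℤ-rawRing -Raw-AlmostCommutative⟶ R-almost
  morphism = record
    { ⟦_⟧ = ⟦_⟧ℤ ; +-homo = +-homo ; *-homo = *-homo ; -‿homo = -‿homo
    ; 0-homo = refl ; 1-homo = +-identityʳ 1# }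

  coefficient-≟ : ∀ i j → Maybe (⟦ i ⟧ℤ ≈ ⟦ j ⟧ℤ)
  coefficient-≟ i j with i ℤ.≟ j
  ... | yes ≡.refl = just refl
  ... | no _       = nothing

  open import Algebra.Solver.Ring ℤ-rawRing R-almost morphism coefficient-≟ public
    using (solve; _:=_; _:+_; _:*_; _:-_; :-_)

module HoradamSequences {c ℓ : Level} (R : CommutativeRing c ℓ) (p q : CommutativeRing.Carrier R) where
  open CommutativeRing R renaming (_+_ to _+R_)
  open Quat R using (pow; horadam; fib)
  open IntegerCoefficientSolver R using (solve; _:=_; _:+_; _:*_; _:-_; :-_)
  open import Algebra.Properties.CommutativeSemigroup *-commutativeSemigroup using (x∙yz≈yx∙z)
  open import Relation.Binary.Reasoning.Setoid setoid

  IsHoradam : (ℕ → Carrier) → Set ℓ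
  IsHoradam x = ∀ m → x (suc (suc m)) ≈ p * x (suc m) +R q * x m

  horadam-isHoradam : ∀ a b → IsHoradam (horadam a b p q)
  horadam-isHoradam a b m = refl

  shift-isHoradam : ∀ {x} → IsHoradam x → ∀ k → IsHoradam (λ m → x (k + m))
  shift-isHoradam {x} rec k m = begin
    x (k + suc (suc m))                   ≡⟨ ≡.cong x (ℕP.+-suc k (suc m)) ⟩
    x (suc (k + suc m))                   ≡⟨ ≡.cong (λ t → x (suc t)) (ℕP.+-suc k m) ⟩
    x (suc (suc (k + m)))                 ≈⟨ rec (k + m) ⟩
    p * x (suc (k + m)) +R q * x (k + m)  ≡⟨ ≡.cong (λ t → p * x t +R q * x (k + m)) (ℕP.+-suc k m) ⟨
    p * x (k + suc m) +R q * x (k + m)    ∎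

  u : ℕ → Carrier
  u = fib p q

  addition : ∀ {x} → IsHoradam x → ∀ r m → x (suc r + m) ≈ u (suc r) * x (suc m) +R q * u r * x m
  addition {x} rec zero m = sym (begin
    u 1 * x (suc m) +R q * u 0 * x m  ≈⟨ +-cong (*-identityˡ _) (trans (*-congʳ (zeroʳ q)) (zeroˡ _)) ⟩
    x (suc m) +R 0#                   ≈⟨ +-identityʳ _ ⟩
    x (suc m)                         ∎)
  addition {x} rec (suc zero) m = begin
    x (suc (suc m))                    ≈⟨ rec m ⟩
    p * x (suc m) +R q * x m           ≈⟨ +-cong (*-congʳ u₂≈p) (*-congʳ (*-identityʳ q)) ⟨
    u 2 * x (suc m) +R q * u 1 * x m   ∎
    where
    u₂≈p : u 2 ≈ p
    u₂≈p = trans (+-cong (*-identityʳ p) (zeroʳ q)) (+-identityʳ p)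
  addition {x} rec (suc (suc r)) m = begin
    x (suc (suc (suc r + m)))
      ≈⟨ rec (suc r + m) ⟩
    p * x (suc (suc r) + m) +R q * x (suc r + m)
      ≈⟨ +-cong (*-congˡ (addition rec (suc r) m)) (*-congˡ (addition rec r m)) ⟩
    p * (u (suc (suc r)) * x (suc m) +R q * u (suc r) * x m) +R q * (u (suc r) * x (suc m) +R q * u r * x m)
      ≈⟨ solve 6 (λ p q U₁ U₀ X₁ X₀ →
           p :* ((p :* U₁ :+ q :* U₀) :* X₁ :+ q :* U₁ :* X₀) :+ q :* (U₁ :* X₁ :+ q :* U₀ :* X₀)
             := (p :* (p :* U₁ :+ q :* U₀) :+ q :* U₁) :* X₁ :+ q :* (p :* U₁ :+ q :* U₀) :* X₀)
         refl p q (u (suc r)) (u r) (x (suc m)) (x m) ⟩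
    u (suc (suc (suc r))) * x (suc m) +R q * u (suc (suc r)) * x m
      ∎

  cross : (a b : ℕ → Carrier) → ℕ → ℕ → Carrier
  cross a b m k = a (suc m) * b k - a m * b (suc k)

  cross-step : ∀ {a b} → IsHoradam a → IsHoradam b → ∀ m k →
    cross a b (suc m) (suc k) ≈ - q * cross a b m k
  cross-step {a} {b} recA recB m k = begin
    a (suc (suc m)) * b (suc k) - a (suc m) * b (suc (suc k))
      ≈⟨ +-cong (*-congʳ (recA m)) (-‿cong (*-congˡ (recB k))) ⟩
    (p * a (suc m) +R q * a m) * b (suc k) - a (suc m) * (p * b (suc k) +R q * b k)
      ≈⟨ solve 6 (λ p q A₁ A₀ B₁ B₀ →
           (p :* A₁ :+ q :* A₀) :* B₁ :- A₁ :* (p :* B₁ :+ q :* B₀) := (:- q) :* (A₁ :* B₀ :- A₀ :* B₁))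
         refl p q (a (suc m)) (a m) (b (suc k)) (b k) ⟩
    - q * cross a b m k
      ∎

  cross-shift : ∀ {a b} → IsHoradam a → IsHoradam b → ∀ n m k →
    cross a b (n + m) (n + k) ≈ pow (- q) n * cross a b m k
  cross-shift recA recB zero m k = sym (*-identityˡ _)
  cross-shift {a} {b} recA recB (suc n) m k = begin
    cross a b (suc n + m) (suc n + k)        ≈⟨ cross-step recA recB (n + m) (n + k) ⟩
    - q * cross a b (n + m) (n + k)          ≈⟨ *-congˡ (cross-shift recA recB n m k) ⟩
    - q * (pow (- q) n * cross a b m k)      ≈⟨ *-assoc _ _ _ ⟨
    pow (- q) (suc n) * cross a b m k        ∎

  gap-cross : ∀ {a b} → IsHoradam a → IsHoradam b → ∀ r m k →
    a (suc r + m) * b k - a m * b (suc r + k) ≈ u (suc r) * cross a b m k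
  gap-cross {a} {b} recA recB r m k = begin
    a (suc r + m) * b k - a m * b (suc r + k)
      ≈⟨ +-cong (*-congʳ (addition recA r m)) (-‿cong (*-congˡ (addition recB r k))) ⟩
    (u (suc r) * a (suc m) +R q * u r * a m) * b k - a m * (u (suc r) * b (suc k) +R q * u r * b k)
      ≈⟨ solve 7 (λ U₁ U₀ q A₁ A₀ B₁ B₀ →
           (U₁ :* A₁ :+ q :* U₀ :* A₀) :* B₀ :- A₀ :* (U₁ :* B₁ :+ q :* U₀ :* B₀) := U₁ :* (A₁ :* B₀ :- A₀ :* B₁))
         refl (u (suc r)) (u r) q (a (suc m)) (a m) (b (suc k)) (b k) ⟩
    u (suc r) * cross a b m k
      ∎

  vajda : ∀ {a b} → IsHoradam a → IsHoradam b → ∀ n r s →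
    a (n + suc r) * b (n + s) - a n * b (n + suc r + s)
      ≈ pow (- q) n * u (suc r) * (a 1 * b s - a 0 * b (s + 1))
  vajda {a} {b} recA recB n r s = begin
    a (n + suc r) * b (n + s) - a n * b (n + suc r + s)
      ≡⟨ ≡.cong₂ (λ i j → a i * b (n + s) - a n * b j) (ℕP.+-comm n (suc r)) index-shuffle ⟩
    a (suc r + n) * b (n + s) - a n * b (suc r + (n + s))
      ≈⟨ gap-cross recA recB r n (n + s) ⟩
    u (suc r) * cross a b n (n + s)
      ≡⟨ ≡.cong (λ i → u (suc r) * cross a b i (n + s)) (ℕP.+-identityʳ n) ⟨
    u (suc r) * cross a b (n + 0) (n + s)
      ≈⟨ *-congˡ (cross-shift recA recB n 0 s) ⟩
    u (suc r) * (pow (- q) n * cross a b 0 s)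
      ≈⟨ x∙yz≈yx∙z _ _ _ ⟩
    pow (- q) n * u (suc r) * cross a b 0 s
      ≡⟨ ≡.cong (λ t → pow (- q) n * u (suc r) * (a 1 * b s - a 0 * b t)) (ℕP.+-comm 1 s) ⟩
    pow (- q) n * u (suc r) * (a 1 * b s - a 0 * b (s + 1))
      ∎
    where
    index-shuffle : n + suc r + s ≡ suc r + (n + s)
    index-shuffle = ≡.trans (≡.cong (_+ s) (ℕP.+-comm n (suc r))) (ℕP.+-assoc (suc r) n s)

module Quaternions {c ℓ : Level} (R : CommutativeRing c ℓ) where
  open CommutativeRing R renaming (_+_ to _+R_)
  open Quat R
  open IntegerCoefficientSolver R using (solve; _:=_; _:+_; _:*_; _:-_)
  open import Relation.Binary.Reasoning.Setoid setoid

  component : Fin 4 → ℍ → Carrier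
  component 0F = re
  component 1F = ci
  component 2F = cj
  component 3F = ck

  component-horadamQ : ∀ x m i → component i (horadamQ x m) ≡ x (toℕ i + m)
  component-horadamQ x m 0F = ≡.refl
  component-horadamQ x m 1F = ≡.refl
  component-horadamQ x m 2F = ≡.refl
  component-horadamQ x m 3F = ≡.refl

  Proportional : (k x x′ y y′ : Carrier) → Set ℓ
  Proportional k x x′ y y′ = x - x′ ≈ k * (y - y′)

  proportional-+ : ∀ {k x₁ x₁′ y₁ y₁′ x₂ x₂′ y₂ y₂′} →
    Proportional k x₁ x₁′ y₁ y₁′ → Proportional k x₂ x₂′ y₂ y₂′ →
    Proportional k (x₁ +R x₂) (x₁′ +R x₂′) (y₁ +R y₂) (y₁′ +R y₂′)
  proportional-+ {k} {x₁} {x₁′} {y₁} {y₁′} {x₂} {x₂′} {y₂} {y₂′} h₁ h₂ = begin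
    (x₁ +R x₂) - (x₁′ +R x₂′)                 ≈⟨ solve 4 (λ x₁ x₁′ x₂ x₂′ →
                                                    (x₁ :+ x₂) :- (x₁′ :+ x₂′) := (x₁ :- x₁′) :+ (x₂ :- x₂′)) refl x₁ x₁′ x₂ x₂′ ⟩
    (x₁ - x₁′) +R (x₂ - x₂′)                  ≈⟨ +-cong h₁ h₂ ⟩
    k * (y₁ - y₁′) +R k * (y₂ - y₂′)          ≈⟨ solve 5 (λ k y₁ y₁′ y₂ y₂′ →
                                                    k :* (y₁ :- y₁′) :+ k :* (y₂ :- y₂′) := k :* ((y₁ :+ y₂) :- (y₁′ :+ y₂′))) refl k y₁ y₁′ y₂ y₂′ ⟩
    k * ((y₁ +R y₂) - (y₁′ +R y₂′))           ∎

  proportional-− : ∀ {k x₁ x₁′ y₁ y₁′ x₂ x₂′ y₂ y₂′} →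
    Proportional k x₁ x₁′ y₁ y₁′ → Proportional k x₂ x₂′ y₂ y₂′ →
    Proportional k (x₁ - x₂) (x₁′ - x₂′) (y₁ - y₂) (y₁′ - y₂′)
  proportional-− {k} {x₁} {x₁′} {y₁} {y₁′} {x₂} {x₂′} {y₂} {y₂′} h₁ h₂ = begin
    (x₁ - x₂) - (x₁′ - x₂′)                   ≈⟨ solve 4 (λ x₁ x₁′ x₂ x₂′ →
                                                    (x₁ :- x₂) :- (x₁′ :- x₂′) := (x₁ :- x₁′) :- (x₂ :- x₂′)) refl x₁ x₁′ x₂ x₂′ ⟩
    (x₁ - x₁′) - (x₂ - x₂′)                   ≈⟨ +-cong h₁ (-‿cong h₂) ⟩
    k * (y₁ - y₁′) - k * (y₂ - y₂′)           ≈⟨ solve 5 (λ k y₁ y₁′ y₂ y₂′ →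
                                                    k :* (y₁ :- y₁′) :- k :* (y₂ :- y₂′) := k :* ((y₁ :- y₂) :- (y₁′ :- y₂′))) refl k y₁ y₁′ y₂ y₂′ ⟩
    k * ((y₁ - y₂) - (y₁′ - y₂′))             ∎

  -- Each component of A B − C D is a signed sum of the differences
  -- Aᵢ Bⱼ − Cᵢ Dⱼ; so if each of these is k times the corresponding
  -- difference for A′, B′, C′, D′, then A B − C D = k (A′ B′ − C′ D′).
  product-difference-proportional : (k : Carrier) (A B C D A′ B′ C′ D′ : ℍ) →
    (∀ i j → Proportional k (component i A * component j B) (component i C * component j D)
                            (component i A′ * component j B′) (component i C′ * component j D′)) →
    ((A *ℍ B) -ℍ (C *ℍ D)) ≈ℍ (k ·ℍ ((A′ *ℍ B′) -ℍ (C′ *ℍ D′)))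
  product-difference-proportional k A B C D A′ B′ C′ D′ h =
      proportional-− (proportional-− (proportional-− (h 0F 0F) (h 1F 1F)) (h 2F 2F)) (h 3F 3F)
    , proportional-− (proportional-+ (proportional-+ (h 0F 1F) (h 1F 0F)) (h 2F 3F)) (h 3F 2F)
    , proportional-+ (proportional-+ (proportional-− (h 0F 2F) (h 1F 3F)) (h 2F 0F)) (h 3F 1F)
    , proportional-+ (proportional-− (proportional-+ (h 0F 3F) (h 1F 2F)) (h 2F 1F)) (h 3F 0F)

theorem2p3 : {c ℓ : Level} (R : CommutativeRing c ℓ) →
    let open CommutativeRing R renaming (_+_ to _+R_) in
    let open Quat R in
    (p q w0 w1 z0 z1 : Carrier) (n r s : ℕ) → 1 ≤ n → 1 ≤ r → 1 ≤ s →
    let W = horadamQ (horadam w0 w1 p q) in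
    let Z = horadamQ (horadam z0 z1 p q) in
    ((Z (n + r) *ℍ W (n + s)) -ℍ (Z n *ℍ W (n + r + s)))
      ≈ℍ ((pow (- q) n * fib p q r) ·ℍ ((Z 1 *ℍ W s) -ℍ (Z 0 *ℍ W (s + 1))))
theorem2p3 R p q w0 w1 z0 z1 n zero    s _ () _
theorem2p3 R p q w0 w1 z0 z1 n (suc r) s _ _  _ =
  product-difference-proportional _ (Z (n + suc r)) (W (n + s)) (Z n) (W (n + suc r + s))
                                    (Z 1) (W s) (Z 0) (W (s + 1)) coordinatewise
  where
  open CommutativeRing R using (Carrier; -_; _*_)
  open Quat R
  open HoradamSequences R p q
  open Quaternions R
  z w : ℕ → Carrier
  z = horadam z0 z1 p q
  w = horadam w0 w1 p q
  Z W : ℕ → ℍ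
  Z = horadamQ z
  W = horadamQ w
  -- the (i, j) entry of the hypothesis is the scalar identity for the
  -- shifted sequences m ↦ z(i + m) and m ↦ w(j + m)
  coordinatewise : ∀ i j →
    Proportional (pow (- q) n * u (suc r))
      (component i (Z (n + suc r)) * component j (W (n + s))) (component i (Z n) * component j (W (n + suc r + s)))
      (component i (Z 1) * component j (W s)) (component i (Z 0) * component j (W (s + 1)))
  coordinatewise i j
    rewrite component-horadamQ z (n + suc r) i | component-horadamQ w (n + s) j
          | component-horadamQ z n i | component-horadamQ w (n + suc r + s) j
          | component-horadamQ z 1 i | component-horadamQ w s j
          | component-horadamQ z 0 i | component-horadamQ w (s + 1) j
    = vajda (shift-isHoradam (horadam-isHoradam z0 z1) (toℕ i))
            (shift-isHoradam (horadam-isHoradam w0 w1) (toℕ j)) n r s
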